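{- Let $w\in S_n$ and let $D\in RP(w)$ be a highest weight pipe dream. For each row $i$ and each $\ell$, let $j^i_\ell$ denote the column index of the $\ell$-th cross from the left in row $i$ of $D$, when row $i$ contains at least $\ell$ crosses. Then for every fixed $1\le\ell\le\operatorname{wt}(D)_1$, the sequence $(j^i_\ell)$, indexed by the rows $i$ containing at least $\ell$ crosses, is weakly increasing in $i$.
   Context: Index the boxes of the $n\times n$ grid by $(i,j)$, row $i$ from the top, column $j$ from the left. Pipe dreams. A pipe dream is a covering of each box by a cross tile or an elbow tile, where crosses are only allowed in boxes with $i+j\le n$. Connecting tiles gives pipes that enter at the left of each row and exit at the top of a column: a cross lets one pipe pass horizontally and one vertically; an elbow joins the left edge to the top edge and the bottom edge to the right edge. $D$ is a pipe dream for $w$ if the pipe entering row $i$ exits from column $w(i)$. It is reduced if any two pipes cross at most once. $RP(w)$ is the set of reduced pipe dreams for $w$, and $D_+$ is the set of boxes carrying crosses. $\operatorname{wt}(D)\in\mathbb Z^n$ has $i$-th coordinate equal to the number of crosses in row $i$. Pairing process on row $i$. The crosses of row $i$ are considered from right to left. The cross $(i,j)$ is paired with the leftmost not-yet-paired cross of row $i+1$ in a column $\ge j$, if one exists; otherwise it is unpaired. Crosses of row $i+1$ never paired are unpaired. Raising move $e_i$. If after this pairing every cross in row $i+1$ is paired, set $e_i(D)=0$. Otherwise let $(i+1,\ell)$ be the rightmost unpaired cross of row $i+1$, let $q>\ell$ be minimal with $(i+1,q)\notin D_+$, and set $e_i(D)_+=(D_+\setminus\{(i+1,\ell)\})\cup\{(i,q)\}$.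 $D$ is a highest weight pipe dream if $e_i(D)=0$ for all $1\le i<n$. -}

module Defs where

open import Data.Bool using (Bool; true; false; if_then_else_; _∧_; T)
open import Data.Nat using (ℕ; zero; suc; _+_; _*_; _≤_; _<_; _≡ᵇ_; _≤ᵇ_)
open import Data.List using (List; []; _∷_; map; upTo; filterᵇ; reverse; last; length)
open import Data.Bool.ListAction using (any)
open import Data.Maybe using (Maybe; just; nothing)
open import Data.Product using (_×_; _,_)
open import Data.Fin using (Fin; toℕ)
open import Data.Fin.Permutation using (Permutation′; _⟨$⟩ʳ_)
open import Relation.Binary.PropositionalEquality using (_≡_)

-- Conventions: boxes are indexed 1-based by natural numbers (i , j);
-- a configuration of tiles is a function  D : ℕ → ℕ → Bool  with
-- D i j = true  iff box (i , j) carries a cross (i.e. (i,j) ∈ D₊).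
-- All other boxes carry elbows.

Tiles : Set
Tiles = ℕ → ℕ → Bool

IsPipeDream : ℕ → Tiles → Set
IsPipeDream n D = ∀ i j → T (D i j) → (1 ≤ i) × (1 ≤ j) × (i + j ≤ n)

data Dir : Set where
  fromLeft fromBottom : Dir

-- a pipe currently entering box (r , c) from the direction d.
-- r = 0 means the pipe has left the grid through the top of column c.
exitCol : Tiles → (fuel r c : ℕ) → Dir → Maybe ℕ
exitCol D zero r c d = nothing
exitCol D (suc f) zero c d = just c
exitCol D (suc f) (suc r) c fromLeft =
  if D (suc r) c then exitCol D f (suc r) (suc c) fromLeft
                 else exitCol D f r c fromBottom
exitCol D (suc f) (suc r) c fromBottom =
  if D (suc r) c then exitCol D f r c fromBottom
                 else exitCol D f (suc r) (suc c) fromLeft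

crossesOn : Tiles → (fuel r c : ℕ) → Dir → List (ℕ × ℕ)
crossesOn D zero r c d = []
crossesOn D (suc f) zero c d = []
crossesOn D (suc f) (suc r) c fromLeft =
  if D (suc r) c then (suc r , c) ∷ crossesOn D f (suc r) (suc c) fromLeft
                 else crossesOn D f r c fromBottom
crossesOn D (suc f) (suc r) c fromBottom =
  if D (suc r) c then (suc r , c) ∷ crossesOn D f r c fromBottom
                 else crossesOn D f (suc r) (suc c) fromLeft

-- enough fuel: every step decreases the row or increases the column
fuel : ℕ → ℕ
fuel n = 3 * n + 3

pipeExit : ℕ → Tiles → ℕ → Maybe ℕ
pipeExit n D i = exitCol D (fuel n) i 1 fromLeft

pipeCrosses : ℕ → Tiles → ℕ → List (ℕ × ℕ)
pipeCrosses n D i = crossesOn D (fuel n) i 1 fromLeft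

IsPipeDreamFor : (n : ℕ) → Permutation′ n → Tiles → Set
IsPipeDreamFor n w D =
  ∀ (i : Fin n) → pipeExit n D (suc (toℕ i)) ≡ just (suc (toℕ (w ⟨$⟩ʳ i)))

_≡ᵇ²_ : ℕ × ℕ → ℕ × ℕ → Bool
(a , b) ≡ᵇ² (c , d) = (a ≡ᵇ c) ∧ (b ≡ᵇ d)

crossCount : ℕ → Tiles → ℕ → ℕ → ℕ
crossCount n D a b =
  length (filterᵇ (λ x → any (x ≡ᵇ²_) (pipeCrosses n D b)) (pipeCrosses n D a))

IsReduced : ℕ → Tiles → Set
IsReduced n D = ∀ a b → 1 ≤ a → a < b → b ≤ n → crossCount n D a b ≤ 1

InRP : (n : ℕ) → Permutation′ n → Tiles → Set
InRP n w D = IsPipeDream n D × IsPipeDreamFor n w D × IsReduced n D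

columns : ℕ → List ℕ
columns n = map suc (upTo n)

rowCrosses : ℕ → Tiles → ℕ → List ℕ
rowCrosses n D i = filterᵇ (D i) (columns n)

wt : ℕ → Tiles → ℕ → ℕ
wt n D i = length (rowCrosses n D i)

-- 1-based list lookup
nth : List ℕ → ℕ → Maybe ℕ
nth [] k = nothing
nth (x ∷ xs) zero = nothing
nth (x ∷ xs) (suc zero) = just x
nth (x ∷ xs) (suc (suc k)) = nth xs (suc k)

crossCol : ℕ → Tiles → (i ℓ : ℕ) → Maybe ℕ
crossCol n D i ℓ = nth (rowCrosses n D i) ℓ

removeFirstGeq : ℕ → List ℕ → List ℕ
removeFirstGeq c [] = []
removeFirstGeq c (x ∷ xs) = if c ≤ᵇ x then xs else x ∷ removeFirstGeq c xs

-- process crosses of row i (given right to left) against the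
-- still unpaired crosses of row i+1 (increasing); returns the unpaired ones
pairUp : List ℕ → List ℕ → List ℕ
pairUp [] avail = avail
pairUp (c ∷ cs) avail = pairUp cs (removeFirstGeq c avail)

unpaired : ℕ → Tiles → ℕ → List ℕ
unpaired n D i = pairUp (reverse (rowCrosses n D i)) (rowCrosses n D (suc i))

nextFree : Tiles → ℕ → (q f : ℕ) → ℕ
nextFree D r q zero = q
nextFree D r q (suc f) = if D r q then nextFree D r (suc q) f else q

-- e_i(D); nothing stands for e_i(D) = 0
raise : ℕ → Tiles → ℕ → Maybe Tiles
raise n D i with last (unpaired n D i)
... | nothing = nothing
... | just ℓ = just D′
  where
  q : ℕ
  q = nextFree D (suc i) (suc ℓ) (suc n)
  D′ : Tiles
  D′ a b = if (a , b) ≡ᵇ² (suc i , ℓ) then false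
           else if (a , b) ≡ᵇ² (i , q) then true
           else D a b

IsHighestWeight : ℕ → Tiles → Set
IsHighestWeight n D = ∀ i → 1 ≤ i → i < n → raise n D i ≡ nothing

{-# OPTIONS --safe #-}
module Submission where

-- In a highest weight pipe dream every cross of row i+1 is paired with a cross of row i
-- lying weakly to its left.  Hence, for every column t, row i+1 has at most as many
-- crosses in columns ≤ t as row i.  As the crosses of a row are listed increasingly, the
-- ℓ-th one lies in a column ≤ t exactly when at least ℓ crosses lie in columns ≤ t, so
-- the column of the ℓ-th cross can only move right from one row to the next.

open import Defs
open import Data.Nat using (ℕ; suc; _+_; _≤_; _<_; _≤′_; ≤′-refl; ≤′-step; z≤n; s≤s)
open import Data.Nat.Properties
open import Data.Bool using (T)
open import Data.Maybe using (just; nothing)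
open import Data.Product using (_,_; proj₁; proj₂)
open import Data.Fin.Permutation using (Permutation′)
open import Data.List using (List; []; _∷_; [_]; length; filter; reverse; last)
open import Data.List.Properties
  using (length-++; filter-++; filter-accept; filter-reject; filter-none)
open import Data.List.Membership.Propositional using (_∈_)
open import Data.List.Membership.Propositional.Properties using (∈-filter⁻)
open import Data.List.Relation.Unary.Any using (here; there)
import Data.List.Relation.Unary.All as All
open import Data.List.Relation.Unary.AllPairs using (AllPairs; _∷_)
import Data.List.Relation.Unary.AllPairs.Properties as AllPairs
open import Data.List.Relation.Binary.Permutation.Propositional.Properties
  using (↭-length; filter-↭; ↭-reverse)
open import Function using (_∘_; id)
open import Relation.Binary.PropositionalEquality using (_≡_; refl; cong; trans)
open import Relation.Nullary using (¬_; yes; no)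
open import Relation.Nullary.Decidable using (T?; dec-true; dec-false)
open import Algebra.Properties.CommutativeSemigroup +-commutativeSemigroup using (x∙yz≈y∙xz)

count≤ : ℕ → List ℕ → ℕ
count≤ t xs = length (filter (_≤? t) xs)

count≤-∷ : ∀ t x xs → count≤ t (x ∷ xs) ≡ count≤ t [ x ] + count≤ t xs
count≤-∷ t x xs =
  trans (cong length (filter-++ (_≤? t) [ x ] xs)) (length-++ (filter (_≤? t) [ x ]))

count≤-accept : ∀ {t x} xs → x ≤ t → count≤ t (x ∷ xs) ≡ suc (count≤ t xs)
count≤-accept {t} _ x≤t = cong length (filter-accept (_≤? t) x≤t)

count≤-reject : ∀ {t x} xs → ¬ x ≤ t → count≤ t (x ∷ xs) ≡ count≤ t xs
count≤-reject {t} _ x≰t = cong length (filter-reject (_≤? t) x≰t)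

count≤-∷-≤ : ∀ t x xs → count≤ t (x ∷ xs) ≤ suc (count≤ t xs)
count≤-∷-≤ t x xs with x ≤? t
... | yes x≤t = ≤-reflexive (count≤-accept xs x≤t)
... | no x≰t  = ≤-trans (≤-reflexive (count≤-reject xs x≰t)) (n≤1+n _)

count≤-[]-antitone : ∀ t {c x} → c ≤ x → count≤ t [ x ] ≤ count≤ t [ c ]
count≤-[]-antitone t {c} {x} c≤x with x ≤? t
... | yes x≤t
  rewrite count≤-accept [] x≤t | count≤-accept [] (≤-trans c≤x x≤t) = ≤-refl
... | no x≰t
  rewrite count≤-reject [] x≰t = z≤n

removeFirstGeq-accept : ∀ {c x} xs → c ≤ x → removeFirstGeq c (x ∷ xs) ≡ xs
removeFirstGeq-accept {c} {x} xs c≤x rewrite dec-true (c ≤? x) c≤x = refl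

removeFirstGeq-reject : ∀ {c x} xs → ¬ c ≤ x →
                        removeFirstGeq c (x ∷ xs) ≡ x ∷ removeFirstGeq c xs
removeFirstGeq-reject {c} {x} xs c≰x rewrite dec-false (c ≤? x) c≰x = refl

count≤-removeFirstGeq : ∀ t c xs →
  count≤ t xs ≤ count≤ t [ c ] + count≤ t (removeFirstGeq c xs)
count≤-removeFirstGeq t c [] = z≤n
count≤-removeFirstGeq t c (x ∷ xs) with c ≤? x
... | yes c≤x = begin
  count≤ t (x ∷ xs)                               ≡⟨ count≤-∷ t x xs ⟩
  count≤ t [ x ] + count≤ t xs                    ≤⟨ +-monoˡ-≤ _ (count≤-[]-antitone t c≤x) ⟩
  count≤ t [ c ] + count≤ t xs                    ≡⟨ cong (λ ys → count≤ t [ c ] + count≤ t ys)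
                                                          (removeFirstGeq-accept xs c≤x) ⟨
  count≤ t [ c ] + count≤ t (removeFirstGeq c (x ∷ xs)) ∎
  where open ≤-Reasoning
... | no c≰x = begin
  count≤ t (x ∷ xs)                               ≡⟨ count≤-∷ t x xs ⟩
  count≤ t [ x ] + count≤ t xs                    ≤⟨ +-monoʳ-≤ _ (count≤-removeFirstGeq t c xs) ⟩
  count≤ t [ x ] + (count≤ t [ c ] + count≤ t xs′) ≡⟨ x∙yz≈y∙xz (count≤ t [ x ]) _ (count≤ t xs′) ⟩
  count≤ t [ c ] + (count≤ t [ x ] + count≤ t xs′) ≡⟨ cong (count≤ t [ c ] +_) (count≤-∷ t x xs′) ⟨
  count≤ t [ c ] + count≤ t (x ∷ xs′)             ≡⟨ cong (λ ys → count≤ t [ c ] + count≤ t ys)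
                                                          (removeFirstGeq-reject xs c≰x) ⟨
  count≤ t [ c ] + count≤ t (removeFirstGeq c (x ∷ xs)) ∎
  where
  open ≤-Reasoning
  xs′ = removeFirstGeq c xs

count≤-pairUp : ∀ t cs avail → count≤ t avail ≤ count≤ t cs + count≤ t (pairUp cs avail)
count≤-pairUp t []       avail = ≤-refl
count≤-pairUp t (c ∷ cs) avail = begin
  count≤ t avail                             ≤⟨ count≤-removeFirstGeq t c avail ⟩
  count≤ t [ c ] + count≤ t avail′           ≤⟨ +-monoʳ-≤ _ (count≤-pairUp t cs avail′) ⟩
  count≤ t [ c ] + (count≤ t cs + unpaired′) ≡⟨ +-assoc (count≤ t [ c ]) _ _ ⟨
  count≤ t [ c ] + count≤ t cs + unpaired′   ≡⟨ cong (_+ unpaired′) (count≤-∷ t c cs) ⟨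
  count≤ t (c ∷ cs) + unpaired′              ∎
  where
  open ≤-Reasoning
  avail′ = removeFirstGeq c avail
  unpaired′ = count≤ t (pairUp cs avail′)

count≤-reverse : ∀ t xs → count≤ t (reverse xs) ≡ count≤ t xs
count≤-reverse t xs = ↭-length (filter-↭ (_≤? t) (↭-reverse xs))

nth-∈ : ∀ xs ℓ {y} → nth xs ℓ ≡ just y → y ∈ xs
nth-∈ (x ∷ xs) 1             refl = here refl
nth-∈ (x ∷ xs) (suc (suc k)) e    = there (nth-∈ xs (suc k) e)

nth⇒≤count≤ : ∀ {xs} ℓ {j} → AllPairs _≤_ xs → nth xs ℓ ≡ just j → ℓ ≤ count≤ j xs
nth⇒≤count≤ {x ∷ xs} 1 _ refl
  rewrite count≤-accept xs (≤-refl {x}) = s≤s z≤n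
nth⇒≤count≤ {x ∷ xs} (suc (suc k)) (x≤xs ∷ xs↗) e
  rewrite count≤-accept xs (All.lookup x≤xs (nth-∈ xs (suc k) e)) =
    s≤s (nth⇒≤count≤ (suc k) xs↗ e)

nth⇒count≤< : ∀ {xs} ℓ {j t} → AllPairs _≤_ xs → nth xs ℓ ≡ just j → t < j → count≤ t xs < ℓ
nth⇒count≤< {x ∷ xs} 1 {t = t} (x≤xs ∷ _) refl t<x =
  s≤s (≤-reflexive (cong length (filter-none (_≤? t) (<⇒≱ t<x All.∷ All.map t≮ x≤xs))))
  where
  t≮ : ∀ {y} → x ≤ y → ¬ y ≤ t
  t≮ x≤y = <⇒≱ (<-≤-trans t<x x≤y)
nth⇒count≤< {x ∷ xs} (suc (suc k)) {t = t} (_ ∷ xs↗) e t<j =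
  ≤-<-trans (count≤-∷-≤ t x xs) (s≤s (nth⇒count≤< (suc k) xs↗ e t<j))

count≤-dominance⇒nth-≤ : ∀ {xs ys} ℓ {j j′} → AllPairs _≤_ xs → AllPairs _≤_ ys →
  nth xs ℓ ≡ just j → nth ys ℓ ≡ just j′ → count≤ j′ ys ≤ count≤ j′ xs → j ≤ j′
count≤-dominance⇒nth-≤ ℓ xs↗ ys↗ e e′ dom = ≮⇒≥ λ j′<j →
  <⇒≱ (nth⇒count≤< ℓ xs↗ e j′<j) (≤-trans (nth⇒≤count≤ ℓ ys↗ e′) dom)

rowCrosses-sorted : ∀ n D i → AllPairs _≤_ (rowCrosses n D i)
rowCrosses-sorted n D i =
  AllPairs.filter⁺ (T? ∘ D i)
    (AllPairs.map⁺ (AllPairs.applyUpTo⁺₁ id n (λ i<j _ → s≤s (<⇒≤ i<j))))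

crossCol-cross : ∀ n D i ℓ {j} → crossCol n D i ℓ ≡ just j → T (D i j)
crossCol-cross n D i ℓ e =
  proj₂ (∈-filter⁻ (T? ∘ D i) {xs = columns n} (nth-∈ (rowCrosses n D i) ℓ e))

rowCrosses-beyond : ∀ {n D i} → IsPipeDream n D → n ≤ i → rowCrosses n D (suc i) ≡ []
rowCrosses-beyond {n} {D} {i} pd n≤i =
  filter-none (T? ∘ D (suc i)) (All.universal no-cross (columns n))
  where
  no-cross : ∀ j → ¬ T (D (suc i) j)
  no-cross j cross = 1+n≰n (begin
    suc i     ≤⟨ m≤m+n (suc i) j ⟩
    suc i + j ≤⟨ proj₂ (proj₂ (pd (suc i) j cross)) ⟩
    n         ≤⟨ n≤i ⟩
    i         ∎)
    where open ≤-Reasoning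

last≡nothing⇒[] : ∀ {A : Set} (xs : List A) → last xs ≡ nothing → xs ≡ []
last≡nothing⇒[] []           _ = refl
last≡nothing⇒[] (x ∷ [])     ()
last≡nothing⇒[] (x ∷ y ∷ xs) e with () ← last≡nothing⇒[] (y ∷ xs) e

raise≡nothing⇒unpaired≡[] : ∀ n D i → raise n D i ≡ nothing → unpaired n D i ≡ []
raise≡nothing⇒unpaired≡[] n D i e with last (unpaired n D i) in eq
... | nothing = last≡nothing⇒[] _ eq
raise≡nothing⇒unpaired≡[] n D i () | just _

count≤-rowCrosses-suc : ∀ {n D} → IsPipeDream n D → IsHighestWeight n D →
  ∀ {i} t → 1 ≤ i → count≤ t (rowCrosses n D (suc i)) ≤ count≤ t (rowCrosses n D i)
count≤-rowCrosses-suc {n} {D} pd hw {i} t 1≤i with i <? n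
... | no i≮n rewrite rowCrosses-beyond pd (≮⇒≥ i≮n) = z≤n
... | yes i<n = begin
  count≤ t (rowCrosses n D (suc i))         ≤⟨ count≤-pairUp t row↓ (rowCrosses n D (suc i)) ⟩
  count≤ t row↓ + count≤ t (unpaired n D i) ≡⟨ cong (λ ys → count≤ t row↓ + count≤ t ys)
                                                   (raise≡nothing⇒unpaired≡[] n D i (hw i 1≤i i<n)) ⟩
  count≤ t row↓ + 0                         ≡⟨ +-identityʳ _ ⟩
  count≤ t row↓                             ≡⟨ count≤-reverse t (rowCrosses n D i) ⟩
  count≤ t (rowCrosses n D i)               ∎
  where
  open ≤-Reasoning
  row↓ = reverse (rowCrosses n D i)

count≤-rowCrosses-antitone : ∀ {n D} → IsPipeDream n D → IsHighestWeight n D →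
  ∀ {i i′} t → 1 ≤ i → i ≤ i′ → count≤ t (rowCrosses n D i′) ≤ count≤ t (rowCrosses n D i)
count≤-rowCrosses-antitone {n} {D} pd hw {i} t 1≤i i≤i′ = go (≤⇒≤′ i≤i′)
  where
  go : ∀ {i′} → i ≤′ i′ → count≤ t (rowCrosses n D i′) ≤ count≤ t (rowCrosses n D i)
  go ≤′-refl        = ≤-refl
  go (≤′-step i≤′m) = ≤-trans (count≤-rowCrosses-suc pd hw t (≤-trans 1≤i (≤′⇒≤ i≤′m))) (go i≤′m)

lemma2p15 : (n : ℕ) (w : Permutation′ n) (D : Tiles) →
    InRP n w D → IsHighestWeight n D →
    ∀ (ℓ i i′ j j′ : ℕ) → 1 ≤ ℓ → ℓ ≤ wt n D 1 → i ≤ i′ →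
    crossCol n D i ℓ ≡ just j → crossCol n D i′ ℓ ≡ just j′ → j ≤ j′
lemma2p15 n w D (pd , _ , _) hw ℓ i i′ j j′ _ _ i≤i′ e e′ =
  count≤-dominance⇒nth-≤ ℓ (rowCrosses-sorted n D i) (rowCrosses-sorted n D i′) e e′
    (count≤-rowCrosses-antitone pd hw j′ 1≤i i≤i′)
  where
  1≤i : 1 ≤ i
  1≤i = proj₁ (pd i j (crossCol-cross n D i ℓ e))
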